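{- Let $\Lambda$ be a ring with identity and $A,B,C,D\in\Lambda$. Then $G(w^*)^{ -1}-G(w)^{ -1}=(B-D)z$ in $\Lambda[[z]]$.
   Context: A walk of length $l\ge0$ is an $(l+1)$-tuple $\alpha=(\alpha_0,\dots,\alpha_l)$ of integers with each $\alpha_i-\alpha_{i-1}\in\{ -1,0,1\}$; it is a walk from $\alpha_0$ to $\alpha_l$. Weights: $w(\alpha)=1$ if $l=0$, else $w(\alpha)=U_1\cdots U_l$ with $U_i=A,B,C$ according as $\alpha_i-\alpha_{i-1}=-1,0,1$; $w^*(\alpha)$ is defined the same way except that $U_i=D$ (instead of $B$) whenever $\alpha_{i-1}=\alpha_i=0$. A walk is standard if $\alpha_i\ge\alpha_l$ for all $i$. $G(w)=\sum w(\alpha)z^{l(\alpha)}$ and $G(w^*)=\sum w^*(\alpha)z^{l(\alpha)}$, both sums over all standard walks from $0$ to $0$; both have constant term $1$ and so are invertible in $\Lambda[[z]]$. -}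

module Defs where

open import Level using (Level)
open import Algebra.Bundles using (Ring)
open import Data.Nat using (ℕ; zero; suc; _∸_)
open import Data.Integer as ℤ using (ℤ; +_; -[1+_])
import Data.Integer.Properties as ℤP
open import Data.List using (List; []; _∷_; [_]; map; concatMap; filterᵇ; foldr; upTo)
open import Data.Bool using (Bool; true; false; _∧_; if_then_else_)
open import Relation.Nullary using (does)

data Step : Set where
  down flat up : Step

stepVal : Step → ℤ
stepVal down = -[1+ 0 ]
stepVal flat = + 0
stepVal up   = + 1

-- all step sequences of length l (a walk starting at 0 is determined by its steps)
allStepLists : ℕ → List (List Step)
allStepLists zero    = [ [] ]
allStepLists (suc n) =
  concatMap (λ s → map (s ∷_) (allStepLists n)) (down ∷ flat ∷ up ∷ [])

positions : ℤ → List Step → List ℤ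
positions p []       = [ p ]
positions p (s ∷ ss) = p ∷ positions (p ℤ.+ stepVal s) ss

endPos : ℤ → List Step → ℤ
endPos p []       = p
endPos p (s ∷ ss) = endPos (p ℤ.+ stepVal s) ss

allB : {A : Set} → (A → Bool) → List A → Bool
allB P []       = true
allB P (x ∷ xs) = P x ∧ allB P xs

isStd00 : List Step → Bool
isStd00 ss =
  does (endPos (+ 0) ss ℤ.≟ + 0)
  ∧ allB (λ a → does (endPos (+ 0) ss ℤ.≤? a)) (positions (+ 0) ss)

stdWalks : ℕ → List (List Step)
stdWalks l = filterᵇ isStd00 (allStepLists l)

module WalkSeries {c ℓ : Level} (R : Ring c ℓ) where
  open Ring R

  Series : Set c
  Series = ℕ → Carrier

  sumL : List Carrier → Carrier
  sumL = foldr _+_ 0#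

  -- Cauchy product (order matters: Λ need not be commutative)
  _·_ : Series → Series → Series
  (f · g) n = sumL (map (λ k → f k * g (n ∸ k)) (upTo (suc n)))

  one : Series
  one zero    = 1#
  one (suc _) = 0#

  _≋_ : Series → Series → Set ℓ
  f ≋ g = ∀ n → f n ≈ g n

  _⊖_ : Series → Series → Series
  (f ⊖ g) n = f n - g n

  IsInverseOf : Series → Series → Set ℓ
  IsInverseOf g f = ((f · g) ≋ one) Data.Product.× ((g · f) ≋ one)
    where import Data.Product

  monomial1 : Carrier → Series
  monomial1 a zero          = 0#
  monomial1 a (suc zero)    = a
  monomial1 a (suc (suc _)) = 0#

  w : (A B C : Carrier) → List Step → Carrier
  w A B C []          = 1#
  w A B C (down ∷ ss) = A * w A B C ss
  w A B C (flat ∷ ss) = B * w A B C ss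
  w A B C (up ∷ ss)   = C * w A B C ss

  wstar : (A B C D : Carrier) → ℤ → List Step → Carrier
  wstar A B C D p []          = 1#
  wstar A B C D p (down ∷ ss) = A * wstar A B C D (p ℤ.+ stepVal down) ss
  wstar A B C D p (flat ∷ ss) =
    (if does (p ℤ.≟ + 0) then D else B) * wstar A B C D p ss
  wstar A B C D p (up ∷ ss)   = C * wstar A B C D (p ℤ.+ stepVal up) ss

  G : (A B C : Carrier) → Series
  G A B C l = sumL (map (w A B C) (stdWalks l))

  Gstar : (A B C D : Carrier) → Series
  Gstar A B C D l = sumL (map (wstar A B C D (+ 0)) (stdWalks l))

module Submission where

-- Let F_b(h) be the generating series of standard walks from height h to 0 in which a
-- flat step at height k has weight b k (standardSeries b h), so that G(w) = F_B(0) and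
-- G(w*) = F_b*(0) with b* = D at height 0 and B above.  The first step of a walk gives
-- F_b(h) = δ₀ h + z (A F_b(h-1) + b h F_b(h) + C F_b(h+1)).  For weights b, b' that agree
-- off the floor, F_b(h) - F_b'(h) and F_b'(h) (b 0 - b' 0) z F_b(0) solve the same
-- inhomogeneous recurrence in (h, n), hence coincide.  At h = 0 this says
-- G(w) - G(w*) = G(w*) (B - D) z G(w), and the resolvent identity
-- X - Y = X (G(w) - G(w*)) Y for X = G(w*)⁻¹, Y = G(w)⁻¹ gives X - Y = (B - D) z.

open import Defs
open import Level using (Level)
open import Algebra.Bundles using (Ring)
open import Data.Nat using (ℕ; zero; suc; _∸_)
import Data.Nat.Properties as ℕ
open import Data.Bool using (Bool; true; false; _∧_; if_then_else_)
import Data.Bool.Properties as Bool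
open import Data.Integer as ℤ using (ℤ; +_)
open import Data.List using (List; []; _∷_; map; _++_; filterᵇ; applyUpTo)
import Data.List.Properties as List
open import Data.Product using (_×_; _,_)
open import Function using (_∘_)
open import Function.Indexed.Relation.Binary.Equality using (≡-setoid)
open import Relation.Binary.Bundles using (Setoid)
open import Relation.Binary.Indexed.Heterogeneous.Construct.Trivial using (indexedSetoid)
open import Relation.Binary.PropositionalEquality as ≡ using (_≡_)
open import Relation.Nullary using (does; yes; no)
import Relation.Binary.Reasoning.Setoid as SetoidReasoning
import Algebra.Properties.AbelianGroup as AbelianGroupProperties
import Algebra.Properties.CommutativeSemigroup as CommutativeSemigroupProperties
import Algebra.Properties.Ring as RingProperties

-- The flat and up clauses come first so that they compute for a variable height.
isStandardFrom : ℕ → List Step → Bool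
isStandardFrom h       (flat ∷ ss) = isStandardFrom h ss
isStandardFrom h       (up ∷ ss)   = isStandardFrom (suc h) ss
isStandardFrom zero    []          = true
isStandardFrom (suc _) []          = false
isStandardFrom zero    (down ∷ _)  = false
isStandardFrom (suc h) (down ∷ ss) = isStandardFrom h ss

isStandardFromℤ : ℤ → List Step → Bool
isStandardFromℤ p ss =
  does (endPos p ss ℤ.≟ + 0) ∧ allB (λ a → does (+ 0 ℤ.≤? a)) (positions p ss)

∧-at-0 : ∀ e (P : ℤ → Bool) → does (e ℤ.≟ + 0) ∧ P e ≡ does (e ℤ.≟ + 0) ∧ P (+ 0)
∧-at-0 e P with e ℤ.≟ + 0
... | yes ≡.refl = ≡.refl
... | no _       = ≡.refl

isStd00≡isStandardFromℤ : ∀ ss → isStd00 ss ≡ isStandardFromℤ (+ 0) ss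
isStd00≡isStandardFromℤ ss =
  ∧-at-0 (endPos (+ 0) ss) (λ e → allB (λ a → does (e ℤ.≤? a)) (positions (+ 0) ss))

isStandardFromℤ-+ : ∀ h ss → isStandardFromℤ (+ h) ss ≡ isStandardFrom h ss
isStandardFromℤ-+ h       (flat ∷ ss) rewrite ℕ.+-identityʳ h = isStandardFromℤ-+ h ss
isStandardFromℤ-+ h       (up ∷ ss)   rewrite ℕ.+-comm h 1 = isStandardFromℤ-+ (suc h) ss
isStandardFromℤ-+ zero    []              = ≡.refl
isStandardFromℤ-+ (suc h) []              = ≡.refl
isStandardFromℤ-+ zero    (down ∷ [])     = ≡.refl
isStandardFromℤ-+ zero    (down ∷ s ∷ ss) = Bool.∧-zeroʳ _
isStandardFromℤ-+ (suc h) (down ∷ ss)     = isStandardFromℤ-+ h ss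

isStd00≡isStandardFrom0 : ∀ ss → isStd00 ss ≡ isStandardFrom 0 ss
isStd00≡isStandardFrom0 ss =
  ≡.trans (isStd00≡isStandardFromℤ ss) (isStandardFromℤ-+ 0 ss)

module RingArithmetic {c ℓ} (R : Ring c ℓ) where
  open Ring R
  open SetoidReasoning setoid
  open AbelianGroupProperties +-abelianGroup using (⁻¹-∙-comm)
  open CommutativeSemigroupProperties +-commutativeSemigroup using (interchange)
  open RingProperties R using (x[y-z]≈xy-xz; [y-z]x≈yx-zx)

  [x+y]-[u+v]≈[x-u]+[y-v] : ∀ x y u v → (x + y) - (u + v) ≈ (x - u) + (y - v)
  [x+y]-[u+v]≈[x-u]+[y-v] x y u v =
    trans (+-congˡ (sym (⁻¹-∙-comm u v))) (interchange x y (- u) (- v))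

  xu-yv≈[x-y]u+y[u-v] : ∀ x y u v → x * u - y * v ≈ (x - y) * u + y * (u - v)
  xu-yv≈[x-y]u+y[u-v] x y u v = sym (begin
    (x - y) * u + y * (u - v)             ≈⟨ +-cong ([y-z]x≈yx-zx u x y) (x[y-z]≈xy-xz y u v) ⟩
    (x * u - y * u) + (y * u - y * v)     ≈⟨ +-assoc _ _ _ ⟩
    x * u + (- (y * u) + (y * u - y * v)) ≈⟨ +-congˡ (sym (+-assoc _ _ _)) ⟩
    x * u + ((- (y * u) + y * u) - y * v) ≈⟨ +-congˡ (+-congʳ (-‿inverseˡ _)) ⟩
    x * u + (0# - y * v)                  ≈⟨ +-congˡ (+-identityˡ _) ⟩
    x * u - y * v                         ∎)

module ListSums {c ℓ} (R : Ring c ℓ) where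
  open Ring R
  open WalkSeries R using (sumL)

  sum-map-++ : ∀ {a} {X : Set a} (f : X → Carrier) xs ys →
               sumL (map f (xs ++ ys)) ≈ sumL (map f xs) + sumL (map f ys)
  sum-map-++ f []       ys = sym (+-identityˡ _)
  sum-map-++ f (x ∷ xs) ys = trans (+-congˡ (sum-map-++ f xs ys)) (sym (+-assoc _ _ _))

  sum-map-cong : ∀ {a} {X : Set a} {f g : X → Carrier} →
                 (∀ x → f x ≈ g x) → ∀ xs → sumL (map f xs) ≈ sumL (map g xs)
  sum-map-cong f≈g []       = refl
  sum-map-cong f≈g (x ∷ xs) = +-cong (f≈g x) (sum-map-cong f≈g xs)

  sum-map-*ˡ : ∀ {a} {X : Set a} k (f : X → Carrier) xs →
               sumL (map (λ x → k * f x) xs) ≈ k * sumL (map f xs)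
  sum-map-*ˡ k f []       = sym (zeroʳ k)
  sum-map-*ˡ k f (x ∷ xs) = trans (+-congˡ (sum-map-*ˡ k f xs)) (sym (distribˡ k _ _))

  sum-map-0# : ∀ {a} {X : Set a} (xs : List X) → sumL (map (λ _ → 0#) xs) ≈ 0#
  sum-map-0# []       = refl
  sum-map-0# (x ∷ xs) = trans (+-congˡ (sum-map-0# xs)) (+-identityˡ 0#)

  sum-map-filterᵇ : ∀ {a} {X : Set a} (p : X → Bool) (f : X → Carrier) xs →
    sumL (map f (filterᵇ p xs)) ≈ sumL (map (λ x → if p x then f x else 0#) xs)
  sum-map-filterᵇ p f []       = refl
  sum-map-filterᵇ p f (x ∷ xs) with p x
  ... | true  = +-congˡ (sum-map-filterᵇ p f xs)
  ... | false = trans (sum-map-filterᵇ p f xs) (sym (+-identityˡ _))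

module PowerSeries {c ℓ} (R : Ring c ℓ) where
  open Ring R hiding (zero)
  open WalkSeries R
  open RingArithmetic R
  open RingProperties R using (x[y-z]≈xy-xz; [y-z]x≈yx-zx)
  open CommutativeSemigroupProperties +-commutativeSemigroup using (interchange)

  infixl 7 _⋆_ _*ₗ_
  infixl 6 _⊕_

  _⋆_ : Series → Series → Series
  (f ⋆ g) zero    = f 0 * g 0
  (f ⋆ g) (suc n) = f 0 * g (suc n) + ((f ∘ suc) ⋆ g) n

  _⊕_ : Series → Series → Series
  (f ⊕ g) n = f n + g n

  _*ₗ_ : Carrier → Series → Series
  (a *ₗ f) n = a * f n

  0ₛ : Series
  0ₛ _ = 0#

  ≋-setoid : Setoid c ℓ
  ≋-setoid = ≡-setoid ℕ (indexedSetoid setoid)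

  open Setoid ≋-setoid public using () renaming (refl to ≋-refl; sym to ≋-sym)

  ⊕-cong : ∀ {f f′ g g′} → f ≋ f′ → g ≋ g′ → (f ⊕ g) ≋ (f′ ⊕ g′)
  ⊕-cong f≋f′ g≋g′ n = +-cong (f≋f′ n) (g≋g′ n)

  ⊖-cong : ∀ {f f′ g g′} → f ≋ f′ → g ≋ g′ → (f ⊖ g) ≋ (f′ ⊖ g′)
  ⊖-cong f≋f′ g≋g′ n = +-cong (f≋f′ n) (-‿cong (g≋g′ n))

  ⋆-cong : ∀ {f f′ g g′} → f ≋ f′ → g ≋ g′ → (f ⋆ g) ≋ (f′ ⋆ g′)
  ⋆-cong f≋f′ g≋g′ zero    = *-cong (f≋f′ 0) (g≋g′ 0)
  ⋆-cong f≋f′ g≋g′ (suc n) = +-cong (*-cong (f≋f′ 0) (g≋g′ (suc n))) (⋆-cong (f≋f′ ∘ suc) g≋g′ n)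

  ·≋⋆ : ∀ f g → (f · g) ≋ (f ⋆ g)
  ·≋⋆ f g n = trans (reflexive (≡.cong sumL (List.map-upTo _ (suc n)))) (sum≈⋆ f n)
    where
    sum≈⋆ : ∀ f n → sumL (applyUpTo (λ k → f k * g (n ∸ k)) (suc n)) ≈ (f ⋆ g) n
    sum≈⋆ f zero    = +-identityʳ _
    sum≈⋆ f (suc n) = +-congˡ (sum≈⋆ (f ∘ suc) n)

  ⋆-zeroˡ : ∀ g → (0ₛ ⋆ g) ≋ 0ₛ
  ⋆-zeroˡ g zero    = zeroˡ (g 0)
  ⋆-zeroˡ g (suc n) = trans (+-cong (zeroˡ (g (suc n))) (⋆-zeroˡ g n)) (+-identityˡ 0#)

  ⋆-identityˡ : ∀ g → (one ⋆ g) ≋ g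
  ⋆-identityˡ g zero    = *-identityˡ (g 0)
  ⋆-identityˡ g (suc n) = trans (+-cong (*-identityˡ (g (suc n))) (⋆-zeroˡ g n)) (+-identityʳ _)

  ⋆-identityʳ : ∀ f → (f ⋆ one) ≋ f
  ⋆-identityʳ f zero    = *-identityʳ (f 0)
  ⋆-identityʳ f (suc n) = trans (+-cong (zeroʳ (f 0)) (⋆-identityʳ (f ∘ suc) n)) (+-identityˡ _)

  *ₗ-⋆-assoc : ∀ a f g → ((a *ₗ f) ⋆ g) ≋ (a *ₗ (f ⋆ g))
  *ₗ-⋆-assoc a f g zero    = *-assoc a (f 0) (g 0)
  *ₗ-⋆-assoc a f g (suc n) =
    trans (+-cong (*-assoc a (f 0) (g (suc n))) (*ₗ-⋆-assoc a (f ∘ suc) g n)) (sym (distribˡ a _ _))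

  ⋆-distribʳ-⊕ : ∀ f g h → ((f ⊕ g) ⋆ h) ≋ ((f ⋆ h) ⊕ (g ⋆ h))
  ⋆-distribʳ-⊕ f g h zero    = distribʳ (h 0) (f 0) (g 0)
  ⋆-distribʳ-⊕ f g h (suc n) =
    trans (+-cong (distribʳ (h (suc n)) (f 0) (g 0)) (⋆-distribʳ-⊕ (f ∘ suc) (g ∘ suc) h n))
          (interchange _ _ _ _)

  ⋆-distribˡ-⊖ : ∀ f g h → (f ⋆ (g ⊖ h)) ≋ ((f ⋆ g) ⊖ (f ⋆ h))
  ⋆-distribˡ-⊖ f g h zero    = x[y-z]≈xy-xz (f 0) (g 0) (h 0)
  ⋆-distribˡ-⊖ f g h (suc n) =
    trans (+-cong (x[y-z]≈xy-xz (f 0) (g (suc n)) (h (suc n))) (⋆-distribˡ-⊖ (f ∘ suc) g h n))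
          (sym ([x+y]-[u+v]≈[x-u]+[y-v] _ _ _ _))

  ⋆-distribʳ-⊖ : ∀ f g h → ((f ⊖ g) ⋆ h) ≋ ((f ⋆ h) ⊖ (g ⋆ h))
  ⋆-distribʳ-⊖ f g h zero    = [y-z]x≈yx-zx (h 0) (f 0) (g 0)
  ⋆-distribʳ-⊖ f g h (suc n) =
    trans (+-cong ([y-z]x≈yx-zx (h (suc n)) (f 0) (g 0)) (⋆-distribʳ-⊖ (f ∘ suc) (g ∘ suc) h n))
          (sym ([x+y]-[u+v]≈[x-u]+[y-v] _ _ _ _))

  ⋆-assoc : ∀ f g h → (f ⋆ (g ⋆ h)) ≋ ((f ⋆ g) ⋆ h)
  ⋆-assoc f g h zero    = sym (*-assoc (f 0) (g 0) (h 0))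
  ⋆-assoc f g h (suc n) = begin
    f 0 * (g 0 * h (suc n) + ((g ∘ suc) ⋆ h) n) + ((f ∘ suc) ⋆ (g ⋆ h)) n
      ≈⟨ +-congʳ (distribˡ (f 0) _ _) ⟩
    (f 0 * (g 0 * h (suc n)) + f 0 * ((g ∘ suc) ⋆ h) n) + ((f ∘ suc) ⋆ (g ⋆ h)) n
      ≈⟨ +-assoc _ _ _ ⟩
    f 0 * (g 0 * h (suc n)) + (f 0 * ((g ∘ suc) ⋆ h) n + ((f ∘ suc) ⋆ (g ⋆ h)) n)
      ≈⟨ +-cong (sym (*-assoc (f 0) (g 0) (h (suc n))))
                (+-cong (sym (*ₗ-⋆-assoc (f 0) (g ∘ suc) h n)) (⋆-assoc (f ∘ suc) g h n)) ⟩
    (f 0 * g 0) * h (suc n) + (((f 0 *ₗ (g ∘ suc)) ⋆ h) n + (((f ∘ suc) ⋆ g) ⋆ h) n)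
      ≈⟨ +-congˡ (sym (⋆-distribʳ-⊕ (f 0 *ₗ (g ∘ suc)) ((f ∘ suc) ⋆ g) h n)) ⟩
    ((f ⋆ g) ⋆ h) (suc n) ∎
    where open SetoidReasoning setoid

  monomial1-⋆-zero : ∀ a g → (monomial1 a ⋆ g) 0 ≈ 0#
  monomial1-⋆-zero a g = zeroˡ (g 0)

  monomial1-⋆-suc : ∀ a g n → (monomial1 a ⋆ g) (suc n) ≈ a * g n
  monomial1-⋆-suc a g n = trans (+-cong (zeroˡ (g (suc n))) (shifted n)) (+-identityˡ _)
    where
    shifted : ∀ n → ((monomial1 a ∘ suc) ⋆ g) n ≈ a * g n
    shifted zero    = refl
    shifted (suc n) = trans (+-congˡ (⋆-zeroˡ g n)) (+-identityʳ _)

  resolvent-identity : ∀ {M M′ X Y} → (X ⋆ M′) ≋ one → (M ⋆ Y) ≋ one →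
                       (X ⊖ Y) ≋ ((X ⋆ (M ⊖ M′)) ⋆ Y)
  resolvent-identity {M} {M′} {X} {Y} X⋆M′≋1 M⋆Y≋1 = begin
    X ⊖ Y                                ≈⟨ ⊖-cong (λ n → sym (⋆-identityʳ X n)) (λ n → sym (⋆-identityˡ Y n)) ⟩
    (X ⋆ one) ⊖ (one ⋆ Y)                ≈⟨ ⊖-cong (⋆-cong (λ _ → refl) (λ n → sym (M⋆Y≋1 n)))
                                                   (⋆-cong (λ n → sym (X⋆M′≋1 n)) (λ _ → refl)) ⟩
    (X ⋆ (M ⋆ Y)) ⊖ ((X ⋆ M′) ⋆ Y)       ≈⟨ ⊖-cong (⋆-assoc X M Y) (λ _ → refl) ⟩
    ((X ⋆ M) ⋆ Y) ⊖ ((X ⋆ M′) ⋆ Y)       ≈⟨ (λ n → sym (⋆-distribʳ-⊖ (X ⋆ M) (X ⋆ M′) Y n)) ⟩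
    ((X ⋆ M) ⊖ (X ⋆ M′)) ⋆ Y             ≈⟨ ⋆-cong (λ n → sym (⋆-distribˡ-⊖ X M M′ n)) (λ _ → refl) ⟩
    (X ⋆ (M ⊖ M′)) ⋆ Y                   ∎
    where open SetoidReasoning ≋-setoid

  inverse-difference : ∀ {M M′ X Y a} → (M ⊖ M′) ≋ (M′ ⋆ (monomial1 a ⋆ M)) →
                       (X ⋆ M′) ≋ one → (M ⋆ Y) ≋ one → (X ⊖ Y) ≋ monomial1 a
  inverse-difference {M} {M′} {X} {Y} {a} M-M′≋ X⋆M′≋1 M⋆Y≋1 = begin
    X ⊖ Y                                ≈⟨ resolvent-identity X⋆M′≋1 M⋆Y≋1 ⟩
    (X ⋆ (M ⊖ M′)) ⋆ Y                   ≈⟨ ⋆-cong (⋆-cong (λ _ → refl) M-M′≋) (λ _ → refl) ⟩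
    (X ⋆ (M′ ⋆ (az ⋆ M))) ⋆ Y             ≈⟨ ⋆-cong (⋆-assoc X M′ (az ⋆ M)) (λ _ → refl) ⟩
    ((X ⋆ M′) ⋆ (az ⋆ M)) ⋆ Y             ≈⟨ ⋆-cong (⋆-cong X⋆M′≋1 (λ _ → refl)) (λ _ → refl) ⟩
    (one ⋆ (az ⋆ M)) ⋆ Y                  ≈⟨ ⋆-cong (⋆-identityˡ (az ⋆ M)) (λ _ → refl) ⟩
    (az ⋆ M) ⋆ Y                          ≈⟨ (λ n → sym (⋆-assoc az M Y n)) ⟩
    az ⋆ (M ⋆ Y)                          ≈⟨ ⋆-cong (λ _ → refl) M⋆Y≋1 ⟩
    az ⋆ one                              ≈⟨ ⋆-identityʳ az ⟩
    az                                    ∎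
    where
    open SetoidReasoning ≋-setoid
    az = monomial1 a

module WeightedWalks {c ℓ} (R : Ring c ℓ) (A C : Ring.Carrier R) where
  open Ring R hiding (zero)
  open WalkSeries R
  open PowerSeries R
  open ListSums R
  open RingArithmetic R

  δ₀ : ℕ → Carrier
  δ₀ zero    = 1#
  δ₀ (suc _) = 0#

  below : (ℕ → Series) → ℕ → Series
  below F zero    = 0ₛ
  below F (suc h) = A *ₗ F h

  oneStep : (ℕ → Carrier) → (ℕ → Series) → ℕ → Series
  oneStep b F h = below F h ⊕ (b h *ₗ F h ⊕ C *ₗ F (suc h))

  -- Spelled out by cases on h, rather than as oneStep b (standardSeries b) h n, so that
  -- the termination checker sees the recursion on n.
  standardSeries : (ℕ → Carrier) → ℕ → Series
  standardSeries b h zero = δ₀ h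
  standardSeries b zero (suc n) =
    0# + (b 0 * standardSeries b 0 n + C * standardSeries b 1 n)
  standardSeries b (suc h) (suc n) =
    A * standardSeries b h n
      + (b (suc h) * standardSeries b (suc h) n + C * standardSeries b (suc (suc h)) n)

  standardSeries-suc : ∀ b h n → standardSeries b h (suc n) ≡ oneStep b (standardSeries b) h n
  standardSeries-suc b zero    n = ≡.refl
  standardSeries-suc b (suc h) n = ≡.refl

  below-cong : ∀ {F F′} n → (∀ k → F k n ≈ F′ k n) → ∀ h → below F h n ≈ below F′ h n
  below-cong n F≈F′ zero    = refl
  below-cong n F≈F′ (suc h) = *-congˡ (F≈F′ h)

  oneStep-cong : ∀ b {F F′} n → (∀ k → F k n ≈ F′ k n) → ∀ h → oneStep b F h n ≈ oneStep b F′ h n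
  oneStep-cong b n F≈F′ h =
    +-cong (below-cong n F≈F′ h) (+-cong (*-congˡ (F≈F′ h)) (*-congˡ (F≈F′ (suc h))))

  below-⋆ʳ : ∀ F g h → (below F h ⋆ g) ≋ below (λ k → F k ⋆ g) h
  below-⋆ʳ F g zero    = ⋆-zeroˡ g
  below-⋆ʳ F g (suc h) = *ₗ-⋆-assoc A (F h) g

  oneStep-⋆ʳ : ∀ b F g h → (oneStep b F h ⋆ g) ≋ oneStep b (λ k → F k ⋆ g) h
  oneStep-⋆ʳ b F g h = begin
    oneStep b F h ⋆ g
      ≈⟨ ⋆-distribʳ-⊕ (below F h) _ g ⟩
    (below F h ⋆ g) ⊕ ((b h *ₗ F h ⊕ C *ₗ F (suc h)) ⋆ g)
      ≈⟨ ⊕-cong (below-⋆ʳ F g h) (⋆-distribʳ-⊕ (b h *ₗ F h) _ g) ⟩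
    below (λ k → F k ⋆ g) h ⊕ ((b h *ₗ F h) ⋆ g ⊕ (C *ₗ F (suc h)) ⋆ g)
      ≈⟨ ⊕-cong ≋-refl (⊕-cong (*ₗ-⋆-assoc (b h) (F h) g) (*ₗ-⋆-assoc C (F (suc h)) g)) ⟩
    oneStep b (λ k → F k ⋆ g) h ∎
    where open SetoidReasoning ≋-setoid

  oneStep-difference : ∀ b b′ F F′ h n →
    oneStep b F h n - oneStep b′ F′ h n ≈ (b h - b′ h) * F h n + oneStep b′ (λ k → F k ⊖ F′ k) h n
  oneStep-difference b b′ F F′ h n = begin
    oneStep b F h n - oneStep b′ F′ h n
      ≈⟨ [x+y]-[u+v]≈[x-u]+[y-v] _ _ _ _ ⟩
    (below F h n - below F′ h n) + ((b h * F h n + C * F (suc h) n) - (b′ h * F′ h n + C * F′ (suc h) n))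
      ≈⟨ +-cong (below-⊖ h) ([x+y]-[u+v]≈[x-u]+[y-v] _ _ _ _) ⟩
    below Δ h n + ((b h * F h n - b′ h * F′ h n) + (C * F (suc h) n - C * F′ (suc h) n))
      ≈⟨ +-congˡ (+-cong (xu-yv≈[x-y]u+y[u-v] _ _ _ _) (sym (x[y-z]≈xy-xz C _ _))) ⟩
    below Δ h n + (((b h - b′ h) * F h n + b′ h * Δ h n) + C * Δ (suc h) n)
      ≈⟨ +-congˡ (+-assoc _ _ _) ⟩
    below Δ h n + ((b h - b′ h) * F h n + (b′ h * Δ h n + C * Δ (suc h) n))
      ≈⟨ x∙yz≈y∙xz _ _ _ ⟩
    (b h - b′ h) * F h n + oneStep b′ Δ h n ∎
    where
    open SetoidReasoning setoid
    open RingProperties R using (x[y-z]≈xy-xz)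
    open CommutativeSemigroupProperties +-commutativeSemigroup using (x∙yz≈y∙xz)
    Δ : ℕ → Series
    Δ k = F k ⊖ F′ k
    below-⊖ : ∀ h → below F h n - below F′ h n ≈ below Δ h n
    below-⊖ zero    = -‿inverseʳ 0#
    below-⊖ (suc h) = sym (x[y-z]≈xy-xz A _ _)

  sumWalks : ℕ → (List Step → Carrier) → Carrier
  sumWalks n f = sumL (map f (allStepLists n))

  sumWalks-suc : ∀ n f → sumWalks (suc n) f ≈
    sumWalks n (f ∘ (down ∷_)) + (sumWalks n (f ∘ (flat ∷_)) + sumWalks n (f ∘ (up ∷_)))
  sumWalks-suc n f = begin
    sumL (map f (walks down ++ (walks flat ++ (walks up ++ []))))
      ≈⟨ sum-map-++ f (walks down) _ ⟩
    sumL (map f (walks down)) + sumL (map f (walks flat ++ (walks up ++ [])))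
      ≈⟨ +-congˡ (sum-map-++ f (walks flat) _) ⟩
    sumL (map f (walks down)) + (sumL (map f (walks flat)) + sumL (map f (walks up ++ [])))
      ≈⟨ +-congˡ (+-congˡ (trans (sum-map-++ f (walks up) []) (+-identityʳ _))) ⟩
    sumL (map f (walks down)) + (sumL (map f (walks flat)) + sumL (map f (walks up)))
      ≡⟨ ≡.cong₂ _+_ (prepend down) (≡.cong₂ _+_ (prepend flat) (prepend up)) ⟩
    sumWalks n (f ∘ (down ∷_)) + (sumWalks n (f ∘ (flat ∷_)) + sumWalks n (f ∘ (up ∷_))) ∎
    where
    open SetoidReasoning setoid
    walks : Step → List (List Step)
    walks s = map (s ∷_) (allStepLists n)
    prepend : ∀ s → sumL (map f (walks s)) ≡ sumWalks n (f ∘ (s ∷_))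
    prepend s = ≡.cong sumL (≡.sym (List.map-∘ (allStepLists n)))

  module Enumeration (b : ℕ → Carrier) (wt : ℕ → List Step → Carrier)
    (wt-[]   : wt 0 [] ≈ 1#)
    (wt-down : ∀ h ss → wt (suc h) (down ∷ ss) ≈ A * wt h ss)
    (wt-flat : ∀ h ss → wt h (flat ∷ ss) ≈ b h * wt h ss)
    (wt-up   : ∀ h ss → wt h (up ∷ ss) ≈ C * wt (suc h) ss)
    where

    standardWeight : ℕ → List Step → Carrier
    standardWeight h ss = if isStandardFrom h ss then wt h ss else 0#

    sumWalks-standardWeight-*ˡ : ∀ n h k {g : List Step → Carrier} → (∀ ss → g ss ≈ k * wt h ss) →
      sumWalks n (λ ss → if isStandardFrom h ss then g ss else 0#) ≈ k * sumWalks n (standardWeight h)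
    sumWalks-standardWeight-*ˡ n h k g≈kwt =
      trans (sum-map-cong (λ ss → if-*ˡ (isStandardFrom h ss) (g≈kwt ss)) (allStepLists n))
            (sum-map-*ˡ k (standardWeight h) (allStepLists n))
      where
      if-*ˡ : ∀ p {x y} → x ≈ k * y → (if p then x else 0#) ≈ k * (if p then y else 0#)
      if-*ˡ true  x≈ky = x≈ky
      if-*ˡ false _    = sym (zeroʳ k)

    sumWalks-standardWeight : ∀ n h → sumWalks n (standardWeight h) ≈ standardSeries b h n
    sumWalks-standardWeight zero zero    = trans (+-identityʳ _) wt-[]
    sumWalks-standardWeight zero (suc h) = +-identityʳ 0#
    sumWalks-standardWeight (suc n) h = begin
      sumWalks (suc n) (standardWeight h)
        ≈⟨ sumWalks-suc n (standardWeight h) ⟩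
      sumWalks n (standardWeight h ∘ (down ∷_))
        + (sumWalks n (standardWeight h ∘ (flat ∷_)) + sumWalks n (standardWeight h ∘ (up ∷_)))
        ≈⟨ +-cong (downs h) (+-cong (sumWalks-standardWeight-*ˡ n h (b h) (wt-flat h))
                                     (sumWalks-standardWeight-*ˡ n (suc h) C (wt-up h))) ⟩
      below F h n + (b h * sumWalks n (standardWeight h) + C * sumWalks n (standardWeight (suc h)))
        ≈⟨ +-congˡ (+-cong (*-congˡ (sumWalks-standardWeight n h))
                           (*-congˡ (sumWalks-standardWeight n (suc h)))) ⟩
      oneStep b F h n
        ≡⟨ ≡.sym (standardSeries-suc b h n) ⟩
      standardSeries b h (suc n) ∎
      where
      open SetoidReasoning setoid
      F : ℕ → Series
      F = standardSeries b
      downs : ∀ h → sumWalks n (standardWeight h ∘ (down ∷_)) ≈ below F h n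
      downs zero    = sum-map-0# (allStepLists n)
      downs (suc h) = trans (sumWalks-standardWeight-*ˡ n h A (wt-down h))
                            (*-congˡ (sumWalks-standardWeight n h))

    sum-stdWalks : ∀ n → sumL (map (wt 0) (stdWalks n)) ≈ standardSeries b 0 n
    sum-stdWalks n = begin
      sumL (map (wt 0) (stdWalks n))
        ≈⟨ sum-map-filterᵇ isStd00 (wt 0) (allStepLists n) ⟩
      sumWalks n (λ ss → if isStd00 ss then wt 0 ss else 0#)
        ≡⟨ ≡.cong sumL (List.map-cong (λ ss → ≡.cong (if_then wt 0 ss else 0#) (isStd00≡isStandardFrom0 ss))
                                      (allStepLists n)) ⟩
      sumWalks n (standardWeight 0)
        ≈⟨ sumWalks-standardWeight n 0 ⟩
      standardSeries b 0 n ∎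
      where open SetoidReasoning setoid

  module FloorPerturbation (b b′ : ℕ → Carrier) (b≈b′-off-floor : ∀ h → b (suc h) ≈ b′ (suc h)) where

    F F′ : ℕ → Series
    F  = standardSeries b
    F′ = standardSeries b′

    d : Carrier
    d = b 0 - b′ 0

    Solves : (ℕ → Series) → Set ℓ
    Solves X = (∀ h → X h 0 ≈ 0#)
             × (∀ h n → X h (suc n) ≈ δ₀ h * (d * F 0 n) + oneStep b′ X h n)

    solutions-unique : ∀ {X Y} → Solves X → Solves Y → ∀ n h → X h n ≈ Y h n
    solutions-unique (X0 , _) (Y0 , _) zero h = trans (X0 h) (sym (Y0 h))
    solutions-unique sX@(_ , Xsuc) sY@(_ , Ysuc) (suc n) h =
      trans (Xsuc h n)
            (trans (+-congˡ (oneStep-cong b′ n (λ k → solutions-unique sX sY n k) h))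
                   (sym (Ysuc h n)))

    flatDifference : ∀ h n → (b h - b′ h) * F h n ≈ δ₀ h * (d * F 0 n)
    flatDifference zero    n = sym (*-identityˡ _)
    flatDifference (suc h) n = begin
      (b (suc h) - b′ (suc h)) * F (suc h) n ≈⟨ *-congʳ (x≈y⇒x∙y⁻¹≈ε (b≈b′-off-floor h)) ⟩
      0# * F (suc h) n                       ≈⟨ zeroˡ _ ⟩
      0#                                     ≈⟨ zeroˡ _ ⟨
      0# * (d * F 0 n)                       ∎
      where
      open SetoidReasoning setoid
      open AbelianGroupProperties +-abelianGroup using (x≈y⇒x∙y⁻¹≈ε)

    difference-solves : Solves (λ h → F h ⊖ F′ h)
    difference-solves = (λ h → -‿inverseʳ (δ₀ h)) , step
      where
      step : ∀ h n → F h (suc n) - F′ h (suc n) ≈ δ₀ h * (d * F 0 n) + oneStep b′ (λ k → F k ⊖ F′ k) h n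
      step h n rewrite standardSeries-suc b h n | standardSeries-suc b′ h n =
        trans (oneStep-difference b b′ F F′ h n) (+-congʳ (flatDifference h n))

    product-solves : Solves (λ h → F′ h ⋆ (monomial1 d ⋆ F 0))
    product-solves = (λ h → trans (*-congˡ (monomial1-⋆-zero d (F 0))) (zeroʳ (δ₀ h))) , step
      where
      K : Series
      K = monomial1 d ⋆ F 0
      step : ∀ h n → (F′ h ⋆ K) (suc n) ≈ δ₀ h * (d * F 0 n) + oneStep b′ (λ k → F′ k ⋆ K) h n
      step h n = +-cong (*-congˡ (monomial1-⋆-suc d (F 0) n))
                        (trans (⋆-cong (λ i → reflexive (standardSeries-suc b′ h i)) ≋-refl n)
                               (oneStep-⋆ʳ b′ F′ K h n))

    standardSeries-floor-difference : (F 0 ⊖ F′ 0) ≋ (F′ 0 ⋆ (monomial1 d ⋆ F 0))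
    standardSeries-floor-difference n = solutions-unique difference-solves product-solves n 0

module WalkWeights {c ℓ} (R : Ring c ℓ) (A B C D : Ring.Carrier R) where
  open Ring R hiding (zero)
  open WalkSeries R
  open WeightedWalks R A C

  flatWeight flatWeight* : ℕ → Carrier
  flatWeight _ = B
  flatWeight* zero    = D
  flatWeight* (suc _) = B

  G≋standardSeries : G A B C ≋ standardSeries flatWeight 0
  G≋standardSeries = sum-stdWalks
    where open Enumeration flatWeight (λ _ → w A B C) refl (λ _ _ → refl) (λ _ _ → refl) (λ _ _ → refl)

  Gstar≋standardSeries : Gstar A B C D ≋ standardSeries flatWeight* 0
  Gstar≋standardSeries = sum-stdWalks
    where
    wstar-flat : ∀ h ss → wstar A B C D (+ h) (flat ∷ ss) ≈ flatWeight* h * wstar A B C D (+ h) ss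
    wstar-flat zero    ss = refl
    wstar-flat (suc h) ss = refl
    wstar-up : ∀ h ss → wstar A B C D (+ h) (up ∷ ss) ≈ C * wstar A B C D (+ suc h) ss
    wstar-up h ss rewrite ℕ.+-comm h 1 = refl
    open Enumeration flatWeight* (λ h → wstar A B C D (+ h)) refl (λ _ _ → refl) wstar-flat wstar-up

  open FloorPerturbation flatWeight flatWeight* (λ _ → refl) public
    using (standardSeries-floor-difference)

lemma2p10 : ∀ {c ℓ : Level} (R : Ring c ℓ) (A B C D : Ring.Carrier R)
    → (X Y : WalkSeries.Series R)
    → WalkSeries.IsInverseOf R X (WalkSeries.Gstar R A B C D)
    → WalkSeries.IsInverseOf R Y (WalkSeries.G R A B C)
    → WalkSeries._≋_ R (WalkSeries._⊖_ R X Y)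
        (WalkSeries.monomial1 R (Ring._-_ R B D))
lemma2p10 R A B C D X Y (_ , X·G*≋1) (G·Y≋1 , _) =
  inverse-difference standardSeries-floor-difference X⋆M*≋1 M⋆Y≋1
  where
  open Ring R using (trans; sym)
  open WalkSeries R
  open PowerSeries R
  open WeightedWalks R A C using (standardSeries)
  open WalkWeights R A B C D
  X⋆M*≋1 : (X ⋆ standardSeries flatWeight* 0) ≋ one
  X⋆M*≋1 n = trans (⋆-cong ≋-refl (≋-sym Gstar≋standardSeries) n) (trans (sym (·≋⋆ X _ n)) (X·G*≋1 n))
  M⋆Y≋1 : (standardSeries flatWeight 0 ⋆ Y) ≋ one
  M⋆Y≋1 n = trans (⋆-cong (≋-sym G≋standardSeries) ≋-refl n) (trans (sym (·≋⋆ _ Y n)) (G·Y≋1 n))
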